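{- Let $G$ be a simple graph and $u_0v_0\in E(G)$ an edge with $N_G(u_0)\cap N_G(v_0)=\emptyset$. Let $u_1,\ldots,u_s$ be the neighbors of $u_0$ other than $v_0$ and $v_1,\ldots,v_t$ the neighbors of $v_0$ other than $u_0$, where $s,t\geq1$. Let $G'$ be the graph with $V(G')=V(G)$ and $E(G')=\big(E(G)\setminus\{v_0v_i:1\leq i\leq t\}\big)\cup\{u_0v_i:1\leq i\leq t\}$. Then $SO(G')>SO(G)$.
   Context: For a graph $G$ and $v\in V(G)$, $N_G(v)$ is the set of neighbors of $v$ and $d_G(v)=|N_G(v)|$. The Sombor index of $G$ is $SO(G)=\sum_{uv\in E(G)}\sqrt{d_G(u)^2+d_G(v)^2}$. -}

module Defs where

open import Data.Bool using (Bool; true; false; if_then_else_; _∧_; _∨_; not)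
open import Data.Nat using (ℕ; zero; suc; _+_; _*_; _^_; _<_; _≤_; _≤ᵇ_; _≡ᵇ_)
open import Data.Fin using (Fin; toℕ)
open import Data.Fin.Properties using () renaming (_≟_ to _≟ᶠ_)
open import Data.List using (List; []; _∷_; map; concatMap; allFin)
open import Data.Nat.ListAction using (sum)
open import Data.Product using (∃)
open import Relation.Binary.PropositionalEquality using (_≡_)
open import Relation.Nullary.Decidable using (isYes)

record Graph (n : ℕ) : Set where
  field
    adj   : Fin n → Fin n → Bool
    sym   : ∀ x y → adj x y ≡ adj y x
    irrefl : ∀ x → adj x x ≡ false
open Graph public

_==_ : ∀ {n} → Fin n → Fin n → Bool
x == y = isYes (x ≟ᶠ y)

deg : ∀ {n} → (Fin n → Fin n → Bool) → Fin n → ℕ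
deg {n} a v = sum (map (λ w → if a v w then 1 else 0) (allFin n))

-- The list of the values d(u)^2 + d(v)^2 over all edges uv
-- (each unordered edge counted once, via toℕ u < toℕ v).
soTerms : ∀ {n} → (Fin n → Fin n → Bool) → List ℕ
soTerms {n} a =
  concatMap (λ u → concatMap (λ v →
      if (suc (toℕ u) ≤ᵇ toℕ v) ∧ a u v
      then (deg a u ^ 2 + deg a v ^ 2) ∷ []
      else []) (allFin n)) (allFin n)

isqrt : ℕ → ℕ
isqrt zero = zero
isqrt (suc m) with isqrt m
... | r = if (suc r * suc r) ≤ᵇ suc m then suc r else r

csqrt : ℕ → ℕ
csqrt m = if (isqrt m * isqrt m) ≡ᵇ m then isqrt m else suc (isqrt m)

-- Σ_{x ∈ xs} √x < Σ_{y ∈ ys} √y  as real numbers, expressed by the standard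
-- constructive definition of strict order on reals: at some dyadic precision
-- 2^-k, the lower approximation of the right side exceeds the upper
-- approximation of the left side.  (⌊2^k √y⌋ = isqrt (4^k y).)
SqrtSum< : List ℕ → List ℕ → Set
SqrtSum< xs ys = ∃ λ k →
  sum (map (λ x → csqrt (4 ^ k * x)) xs) < sum (map (λ y → isqrt (4 ^ k * y)) ys)

SO< : ∀ {n} → (Fin n → Fin n → Bool) → (Fin n → Fin n → Bool) → Set
SO< a b = SqrtSum< (soTerms a) (soTerms b)

-- The transformed graph G': remove edges v0 v_i (v_i ∈ N(v0) \ {u0}),
-- add edges u0 v_i.
transform : ∀ {n} → (Fin n → Fin n → Bool) → Fin n → Fin n → Fin n → Fin n → Bool
transform a u0 v0 x y =
  (a x y ∧ not (((x == v0) ∧ not (y == u0)) ∨ ((y == v0) ∧ not (x == u0))))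
  ∨ (((x == u0) ∧ a v0 y ∧ not (y == u0)) ∨ ((y == u0) ∧ a v0 x ∧ not (x == u0)))

module Submission where

-- Every edge of G' comes from exactly one edge of G: an edge v0 vi becomes u0 vi, all other
-- edges stay.  Along this correspondence degrees never drop: d'(u0) = d(u0) + d(v0) - 1 is at
-- least d(u0) and d(v0), and d'(w) = d(w) for w ≠ u0, v0.  For u0 v0 itself the squared-degree
-- sum grows strictly, d'(u0)² > d(u0)² + d(v0)², because both degrees are at least 2.  So every
-- term of SO(G) is at most its partner in SO(G'), and strictly smaller for u0 v0.
-- To compare with precision 2^-k, a term's rounded-up approximation ⌈2^k √x⌉ exceeds the
-- rounded-down ⌊2^k √y⌋ of its partner by at most 1, whereas for u0 v0 the rounded-down side wins
-- by more than the number of terms once 2^k is large.  The comparison is done on the double sum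
-- over ordered pairs (which is 2·SO), where the correspondence merges the columns u0 and v0 in
-- every row and the rows u0 and v0.

open import Defs hiding (sym)
open import Data.Bool using (Bool; true; false; T; if_then_else_; _∧_; _∨_; not)
open import Data.Bool.Properties using (∨-comm)
open import Data.Fin using (Fin; zero; suc; toℕ)
open import Data.Fin.Properties using (_≟_; toℕ-injective)
open import Data.List using (List; []; _∷_; _++_; map; tabulate; allFin; concatMap)
open import Data.List.Properties using (map-tabulate; map-++)
open import Data.Nat using (ℕ; zero; suc; _+_; _*_; _^_; _≤_; _<_; _≤ᵇ_; _<ᵇ_; _≡ᵇ_; z≤n; s≤s; >-nonZero)
open import Data.Nat.ListAction using (sum)
open import Data.Nat.ListAction.Properties using (sum-++)
open import Data.Nat.Properties hiding (_≟_)
open import Algebra.Properties.CommutativeMonoid.Sum +-0-commutativeMonoid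
  using (sum-syntax; ∑-comm; ∑-distrib-+; sum-cong-≗; sum-replicate-zero)
  renaming (sum to ∑)
open import Algebra.Properties.CommutativeSemigroup +-commutativeSemigroup
  using (x∙yz≈y∙xz; xy∙z≈xz∙y; interchange)
open import Data.Nat.Tactic.RingSolver using (solve-∀)
open import Data.Product using (_×_; _,_; proj₁; proj₂)
open import Data.Vec.Functional using (updateAt)
open import Data.Vec.Functional.Properties using (updateAt-updates; updateAt-minimal)
open import Function using (_∘_; const; case_of_)
open import Relation.Binary.PropositionalEquality
open import Relation.Nullary using (¬_; yes; no)
open import Data.Empty using (⊥-elim)

-- Integer square roots

isqrt-correct : ∀ m → isqrt m * isqrt m ≤ m × m < suc (isqrt m) * suc (isqrt m)
isqrt-correct zero = z≤n , s≤s z≤n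
isqrt-correct (suc m) with isqrt m | isqrt-correct m
... | r | r²≤m , m<[1+r]² with suc r * suc r ≤ᵇ suc m in eq
... | true  = ≤ᵇ⇒≤ _ _ (subst T (sym eq) _) , ≤-trans (s≤s m<[1+r]²) (*-mono-< (n<1+n (suc r)) (n<1+n (suc r)))
... | false = m≤n⇒m≤1+n r²≤m , ≰⇒> (λ le → subst T eq (≤⇒≤ᵇ le))

≤isqrt : ∀ {s m} → s * s ≤ m → s ≤ isqrt m
≤isqrt {s} {m} s²≤m = ≮⇒≥ λ r<s →
  <⇒≱ (proj₂ (isqrt-correct m)) (≤-trans (*-mono-≤ r<s r<s) s²≤m)

isqrt-mono-≤ : ∀ {x y} → x ≤ y → isqrt x ≤ isqrt y
isqrt-mono-≤ {x} x≤y = ≤isqrt (≤-trans (proj₁ (isqrt-correct x)) x≤y)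

csqrt≤1+isqrt : ∀ m → csqrt m ≤ suc (isqrt m)
csqrt≤1+isqrt m with isqrt m * isqrt m ≡ᵇ m
... | true  = n≤1+n _
... | false = ≤-refl

csqrt[N*x]≤isqrt[N*y]+1 : ∀ N {x y} → x ≤ y → csqrt (N * x) ≤ isqrt (N * y) + 1
csqrt[N*x]≤isqrt[N*y]+1 N {x} {y} x≤y = begin
  csqrt (N * x)           ≤⟨ csqrt≤1+isqrt (N * x) ⟩
  suc (isqrt (N * x))     ≤⟨ s≤s (isqrt-mono-≤ (*-monoʳ-≤ N x≤y)) ⟩
  suc (isqrt (N * y))     ≡⟨ +-comm 1 _ ⟩
  isqrt (N * y) + 1       ∎
  where open ≤-Reasoning

m*m≤n*n⇒m≤n : ∀ {a b} → a * a ≤ b * b → a ≤ b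
m*m≤n*n⇒m≤n a²≤b² = ≮⇒≥ λ b<a → <⇒≱ (*-mono-< b<a b<a) a²≤b²

n≤n*n : ∀ n → n ≤ n * n
n≤n*n zero    = z≤n
n≤n*n (suc n) = m≤m*n (suc n) (suc n)

-- With s = isqrt (r² x) ≤ r x:  (s + H)² ≤ r² x + r (2 x H + H²) ≤ r² (x + 1) ≤ r² y.
csqrt[r²x]+H≤isqrt[r²y]+1 : ∀ r H {x y} → 1 ≤ H → x < y → 2 * x * H + H * H ≤ r →
  csqrt (r * r * x) + H ≤ isqrt (r * r * y) + 1
csqrt[r²x]+H≤isqrt[r²y]+1 r H {x} {y} 1≤H x<y r-large = begin
  csqrt (r * r * x) + H   ≤⟨ +-monoˡ-≤ H (csqrt≤1+isqrt (r * r * x)) ⟩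
  suc (s + H)             ≡⟨ +-comm 1 (s + H) ⟩
  s + H + 1               ≤⟨ +-monoˡ-≤ 1 (≤isqrt square-bound) ⟩
  isqrt (r * r * y) + 1   ∎
  where
  open ≤-Reasoning
  s = isqrt (r * r * x)
  s²≤r²x : s * s ≤ r * r * x
  s²≤r²x = proj₁ (isqrt-correct (r * r * x))
  s≤rx : s ≤ r * x
  s≤rx = m*m≤n*n⇒m≤n (begin
    s * s               ≤⟨ s²≤r²x ⟩
    r * r * x           ≤⟨ *-monoʳ-≤ (r * r) (n≤n*n x) ⟩
    r * r * (x * x)     ≡⟨ rearrange r x ⟩
    r * x * (r * x)     ∎)
    where
    rearrange : ∀ r x → r * r * (x * x) ≡ r * x * (r * x)
    rearrange = solve-∀
  square-bound : (s + H) * (s + H) ≤ r * r * y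
  square-bound = begin
    (s + H) * (s + H)                          ≡⟨ expand s H ⟩
    s * s + 2 * s * H + H * H                  ≤⟨ +-mono-≤ (+-mono-≤ s²≤r²x (*-monoˡ-≤ H (*-monoʳ-≤ 2 s≤rx))) H²≤rH² ⟩
    r * r * x + 2 * (r * x) * H + r * (H * H)  ≡⟨ factor r x H ⟩
    r * r * x + r * (2 * x * H + H * H)        ≤⟨ +-monoʳ-≤ (r * r * x) (*-monoʳ-≤ r r-large) ⟩
    r * r * x + r * r                          ≡⟨ +-comm (r * r * x) (r * r) ⟩
    r * r + r * r * x                          ≡⟨ *-suc (r * r) x ⟨
    r * r * suc x                              ≤⟨ *-monoʳ-≤ (r * r) x<y ⟩
    r * r * y                                  ∎
    where
    expand : ∀ s H → (s + H) * (s + H) ≡ s * s + 2 * s * H + H * H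
    expand = solve-∀
    factor : ∀ r x H → r * r * x + 2 * (r * x) * H + r * (H * H) ≡ r * r * x + r * (2 * x * H + H * H)
    factor = solve-∀
    H²≤rH² : H * H ≤ r * (H * H)
    H²≤rH² = m≤n*m (H * H) r {{>-nonZero (≤-trans (*-mono-≤ 1≤H 1≤H) (m+n≤o⇒n≤o (2 * x * H) r-large))}}

-- Finite sums

sum-tabulate : ∀ {n} (f : Fin n → ℕ) → sum (tabulate f) ≡ ∑ f
sum-tabulate {zero}  f = refl
sum-tabulate {suc n} f = cong (f zero +_) (sum-tabulate (f ∘ suc))

sum-allFin : ∀ {n} (f : Fin n → ℕ) → sum (map f (allFin n)) ≡ ∑ f
sum-allFin f = trans (cong sum (map-tabulate (λ i → i) f)) (sum-tabulate f)

∑f≤∑g+n*c : ∀ {n} {f g : Fin n → ℕ} c → (∀ i → f i ≤ g i + c) → ∑ f ≤ ∑ g + n * c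
∑f≤∑g+n*c {zero}      c f≤g+c = z≤n
∑f≤∑g+n*c {suc n} {f} {g} c f≤g+c = begin
  f zero + ∑ (f ∘ suc)                    ≤⟨ +-mono-≤ (f≤g+c zero) (∑f≤∑g+n*c c (f≤g+c ∘ suc)) ⟩
  (g zero + c) + (∑ (g ∘ suc) + n * c)    ≡⟨ +-assoc (g zero) c _ ⟩
  g zero + (c + (∑ (g ∘ suc) + n * c))    ≡⟨ cong (g zero +_) (x∙yz≈y∙xz c (∑ (g ∘ suc)) (n * c)) ⟩
  g zero + (∑ (g ∘ suc) + (c + n * c))    ≡⟨ +-assoc (g zero) (∑ (g ∘ suc)) (c + n * c) ⟨
  g zero + ∑ (g ∘ suc) + (c + n * c)      ∎
  where open ≤-Reasoning

∑-updateAt : ∀ {n} (p : Fin n) (f : Fin n → ℕ) → ∑ f ≡ f p + ∑ (updateAt f p (const 0))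
∑-updateAt zero    f = refl
∑-updateAt (suc p) f = begin
  f zero + ∑ (f ∘ suc)                                  ≡⟨ cong (f zero +_) (∑-updateAt p (f ∘ suc)) ⟩
  f zero + (f (suc p) + ∑ (updateAt (f ∘ suc) p (const 0))) ≡⟨ x∙yz≈y∙xz (f zero) (f (suc p)) _ ⟩
  f (suc p) + (f zero + ∑ (updateAt (f ∘ suc) p (const 0))) ∎
  where open ≡-Reasoning

∑-≤-pair : ∀ {n} {f g : Fin n → ℕ} {p q : Fin n} c d e → p ≢ q →
  (∀ i → i ≢ p → i ≢ q → f i ≤ g i + c) →
  f p + f q + e ≤ g p + g q + d →
  ∑ f + e ≤ ∑ g + (n * c + d)
∑-≤-pair {n} {f} {g} {p} {q} c d e p≢q f≤g+c pair = begin
  ∑ f + e                                  ≡⟨ cong (_+ e) (split f) ⟩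
  f p + f q + ∑ (rest f) + e               ≡⟨ xy∙z≈xz∙y (f p + f q) (∑ (rest f)) e ⟩
  f p + f q + e + ∑ (rest f)               ≤⟨ +-mono-≤ pair (∑f≤∑g+n*c c rest≤rest+c) ⟩
  g p + g q + d + (∑ (rest g) + n * c)     ≡⟨ interchange (g p + g q) d (∑ (rest g)) (n * c) ⟩
  g p + g q + ∑ (rest g) + (d + n * c)     ≡⟨ cong₂ _+_ (split g) (+-comm (n * c) d) ⟨
  ∑ g + (n * c + d)                        ∎
  where
  open ≤-Reasoning
  rest : (Fin n → ℕ) → Fin n → ℕ
  rest h = updateAt (updateAt h p (const 0)) q (const 0)
  split : ∀ h → ∑ h ≡ h p + h q + ∑ (rest h)
  split h = begin-equality
    ∑ h                                                    ≡⟨ ∑-updateAt p h ⟩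
    h p + ∑ (updateAt h p (const 0))                       ≡⟨ cong (h p +_) (∑-updateAt q _) ⟩
    h p + (updateAt h p (const 0) q + ∑ (rest h))          ≡⟨ cong (λ x → h p + (x + ∑ (rest h))) (updateAt-minimal q p h (p≢q ∘ sym)) ⟩
    h p + (h q + ∑ (rest h))                               ≡⟨ +-assoc (h p) (h q) _ ⟨
    h p + h q + ∑ (rest h)                                 ∎
  rest-p : ∀ h → rest h p ≡ 0
  rest-p h = trans (updateAt-minimal p q {const 0} _ p≢q) (updateAt-updates p h)
  rest-q : ∀ h → rest h q ≡ 0
  rest-q h = updateAt-updates q {const 0} _
  rest-other : ∀ h {i} → i ≢ p → i ≢ q → rest h i ≡ h i
  rest-other h {i} i≢p i≢q = trans (updateAt-minimal i q {const 0} _ i≢q) (updateAt-minimal i p h i≢p)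
  rest≤rest+c : ∀ i → rest f i ≤ rest g i + c
  rest≤rest+c i with i ≟ p | i ≟ q
  ... | yes refl | _        = ≤-trans (≤-reflexive (rest-p f)) z≤n
  ... | no _     | yes refl = ≤-trans (≤-reflexive (rest-q f)) z≤n
  ... | no i≢p   | no i≢q   = subst₂ (λ x y → x ≤ y + c)
    (sym (rest-other f i≢p i≢q)) (sym (rest-other g i≢p i≢q)) (f≤g+c i i≢p i≢q)

==-refl : ∀ {n} (x : Fin n) → (x == x) ≡ true
==-refl x with x ≟ x
... | yes _  = refl
... | no x≢x = ⊥-elim (x≢x refl)

==-≢ : ∀ {n} {x y : Fin n} → x ≢ y → (x == y) ≡ false
==-≢ {x = x} {y} x≢y with x ≟ y
... | yes x≡y = ⊥-elim (x≢y x≡y)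
... | no _    = refl

∑-δ : ∀ {n} (p : Fin n) K → ∑ (λ i → if i == p then K else 0) ≡ K
∑-δ {n} p K = begin
  ∑ δ                                   ≡⟨ ∑-updateAt p δ ⟩
  δ p + ∑ (updateAt δ p (const 0))      ≡⟨ cong₂ _+_ (cong (λ b → if b then K else 0) (==-refl p)) (sum-cong-≗ off-p) ⟩
  K + ∑ {n} (λ _ → 0)                   ≡⟨ cong (K +_) (sum-replicate-zero n) ⟩
  K + 0                                 ≡⟨ +-identityʳ K ⟩
  K                                     ∎
  where
  open ≡-Reasoning
  δ : Fin n → ℕ
  δ i = if i == p then K else 0
  off-p : ∀ i → updateAt δ p (const 0) i ≡ 0
  off-p i with i ≟ p
  ... | yes refl = updateAt-updates i δ
  ... | no i≢p = trans (updateAt-minimal i p δ i≢p) (cong (λ b → if b then K else 0) (==-≢ i≢p))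

-- Sombor sums over ordered pairs of vertices

degSq : ∀ {n} → (Fin n → Fin n → Bool) → Fin n → Fin n → ℕ
degSq a u v = deg a u ^ 2 + deg a v ^ 2

weight : ∀ {n} → (ℕ → ℕ) → (Fin n → Fin n → Bool) → Fin n → Fin n → ℕ
weight h a u v = if a u v then h (degSq a u v) else 0

module _ {n} (G : Graph n) (h : ℕ → ℕ) where

  weight-sym : ∀ u v → weight h (adj G) u v ≡ weight h (adj G) v u
  weight-sym u v = cong₂ (λ b x → if b then h x else 0) (Graph.sym G u v) (+-comm (deg (adj G) u ^ 2) _)

  weight-irrefl : ∀ u → weight h (adj G) u u ≡ 0
  weight-irrefl u = cong (λ b → if b then h (degSq (adj G) u u) else 0) (irrefl G u)

module WeightComparison {n} (h h' : ℕ → ℕ) (a b : Fin n → Fin n → Bool) where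

  weight-absent : ∀ {x y} → b x y ≡ false → weight h' b x y ≡ 0
  weight-absent {x} {y} x≁y = cong (λ β → if β then h' (degSq b x y) else 0) x≁y

  weight-≤ : ∀ {x y x' y'} c → b x' y' ≡ a x y → h (degSq a x y) ≤ h' (degSq b x' y') + c →
    weight h a x y ≤ weight h' b x' y' + c
  weight-≤ {x} {y} {x'} {y'} c same le rewrite same with a x y
  ... | true  = le
  ... | false = z≤n

  weight-merge : ∀ {x y x₂ y₂ x' y'} c → b x' y' ≡ a x y ∨ a x₂ y₂ → ¬ (a x y ≡ true × a x₂ y₂ ≡ true) →
    h (degSq a x y) ≤ h' (degSq b x' y') + c → h (degSq a x₂ y₂) ≤ h' (degSq b x' y') + c →
    weight h a x y + weight h a x₂ y₂ ≤ weight h' b x' y' + c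
  weight-merge {x} {y} {x₂} {y₂} c merged not-both le le₂ rewrite merged with a x y | a x₂ y₂
  ... | true  | true  = ⊥-elim (not-both (refl , refl))
  ... | true  | false = ≤-trans (≤-reflexive (+-identityʳ _)) le
  ... | false | true  = le₂
  ... | false | false = z≤n

sum-map-concatMap : ∀ {A : Set} (h : ℕ → ℕ) (g : A → List ℕ) xs →
  sum (map h (concatMap g xs)) ≡ sum (map (λ x → sum (map h (g x))) xs)
sum-map-concatMap h g []       = refl
sum-map-concatMap h g (x ∷ xs) = begin
  sum (map h (g x ++ concatMap g xs))             ≡⟨ cong sum (map-++ h (g x) _) ⟩
  sum (map h (g x) ++ map h (concatMap g xs))     ≡⟨ sum-++ (map h (g x)) _ ⟩
  sum (map h (g x)) + sum (map h (concatMap g xs))          ≡⟨ cong (sum (map h (g x)) +_) (sum-map-concatMap h g xs) ⟩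
  sum (map h (g x)) + sum (map (λ y → sum (map h (g y))) xs) ∎
  where open ≡-Reasoning

sum-map-singleton-if : ∀ (h : ℕ → ℕ) β γ t →
  sum (map h (if β ∧ γ then t ∷ [] else [])) ≡ (if β then (if γ then h t else 0) else 0)
sum-map-singleton-if h false γ     t = refl
sum-map-singleton-if h true  false t = refl
sum-map-singleton-if h true  true  t = +-identityʳ (h t)

-- toℕ u <ᵇ toℕ v is definitionally the test suc (toℕ u) ≤ᵇ toℕ v made by soTerms.
upper : ∀ {n} → (Fin n → Fin n → ℕ) → Fin n → Fin n → ℕ
upper F u v = if toℕ u <ᵇ toℕ v then F u v else 0

sum-map-soTerms : ∀ {n} (h : ℕ → ℕ) (a : Fin n → Fin n → Bool) →
  sum (map h (soTerms a)) ≡ ∑[ u < n ] ∑[ v < n ] upper (weight h a) u v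
sum-map-soTerms {n} h a = begin
  sum (map h (soTerms a))                                  ≡⟨ sum-map-concatMap h row (allFin n) ⟩
  sum (map (λ u → sum (map h (row u))) (allFin n))         ≡⟨ sum-allFin (λ u → sum (map h (row u))) ⟩
  ∑[ u < n ] sum (map h (row u))                           ≡⟨ sum-cong-≗ {n} (λ u → sum-map-concatMap h (cell u) (allFin n)) ⟩
  ∑[ u < n ] sum (map (λ v → sum (map h (cell u v))) (allFin n))  ≡⟨ sum-cong-≗ {n} (λ u → sum-allFin (λ v → sum (map h (cell u v)))) ⟩
  ∑[ u < n ] ∑[ v < n ] sum (map h (cell u v))             ≡⟨ sum-cong-≗ {n} (λ u → sum-cong-≗ {n} (λ v →
                                                                sum-map-singleton-if h (toℕ u <ᵇ toℕ v) (a u v) _)) ⟩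
  ∑[ u < n ] ∑[ v < n ] upper (weight h a) u v             ∎
  where
  open ≡-Reasoning
  cell : Fin n → Fin n → List ℕ
  cell u v = if (toℕ u <ᵇ toℕ v) ∧ a u v then (deg a u ^ 2 + deg a v ^ 2) ∷ [] else []
  row : Fin n → List ℕ
  row u = concatMap (cell u) (allFin n)

upper+upperᵀ : ∀ {n} (F : Fin n → Fin n → ℕ) → (∀ u v → F u v ≡ F v u) → (∀ u → F u u ≡ 0) →
  ∀ u v → F u v ≡ upper F u v + upper F v u
upper+upperᵀ F F-sym F-diag u v with toℕ u <ᵇ toℕ v in u<v | toℕ v <ᵇ toℕ u in v<u
... | true  | true  = ⊥-elim (<-asym (<ᵇ⇒< (toℕ u) (toℕ v) (subst T (sym u<v) _)) (<ᵇ⇒< (toℕ v) (toℕ u) (subst T (sym v<u) _)))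
... | true  | false = sym (+-identityʳ (F u v))
... | false | true  = F-sym u v
... | false | false = trans (cong (F u) (sym u≡v)) (F-diag u)
  where
  u≡v : u ≡ v
  u≡v = toℕ-injective (≤-antisym (≮⇒≥ (λ lt → subst T v<u (<⇒<ᵇ lt))) (≮⇒≥ (λ lt → subst T u<v (<⇒<ᵇ lt))))

∑∑≡2*∑∑upper : ∀ {n} (F : Fin n → Fin n → ℕ) → (∀ u v → F u v ≡ F v u) → (∀ u → F u u ≡ 0) →
  ∑[ u < n ] ∑[ v < n ] F u v ≡ 2 * ∑[ u < n ] ∑[ v < n ] upper F u v
∑∑≡2*∑∑upper {n} F F-sym F-diag = begin
  ∑[ u < n ] ∑[ v < n ] F u v                                      ≡⟨ sum-cong-≗ {n} (λ u → sum-cong-≗ {n} (upper+upperᵀ F F-sym F-diag u)) ⟩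
  ∑[ u < n ] ∑[ v < n ] (upper F u v + upper F v u)                ≡⟨ sum-cong-≗ {n} (λ u → ∑-distrib-+ (upper F u) (λ v → upper F v u)) ⟩
  ∑[ u < n ] (∑[ v < n ] upper F u v + ∑[ v < n ] upper F v u)     ≡⟨ ∑-distrib-+ (λ u → ∑[ v < n ] upper F u v) _ ⟩
  U + ∑[ u < n ] ∑[ v < n ] upper F v u                            ≡⟨ cong (U +_) (∑-comm (λ u v → upper F v u)) ⟩
  U + U                                                            ≡⟨ cong (U +_) (+-identityʳ U) ⟨
  2 * U                                                            ∎
  where
  open ≡-Reasoning
  U = ∑[ u < n ] ∑[ v < n ] upper F u v

2*sum-map-soTerms : ∀ {n} (G : Graph n) (h : ℕ → ℕ) →
  2 * sum (map h (soTerms (adj G))) ≡ ∑[ u < n ] ∑[ v < n ] weight h (adj G) u v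
2*sum-map-soTerms {n} G h = trans (cong (2 *_) (sum-map-soTerms h (adj G)))
  (sym (∑∑≡2*∑∑upper (weight h (adj G)) (weight-sym G h) (weight-irrefl G h)))

-- The transformed graph

module _ {n} (a : Fin n → Fin n → Bool) (u0 v0 : Fin n) where

  transform-sym : (∀ x y → a x y ≡ a y x) → ∀ x y → transform a u0 v0 x y ≡ transform a u0 v0 y x
  transform-sym a-sym x y = cong₂ _∨_
    (cong₂ _∧_ (a-sym x y) (cong not (∨-comm ((x == v0) ∧ not (y == u0)) ((y == v0) ∧ not (x == u0)))))
    (∨-comm ((x == u0) ∧ a v0 y ∧ not (y == u0)) ((y == u0) ∧ a v0 x ∧ not (x == u0)))

  transform-irrefl : (∀ x → a x x ≡ false) → ∀ x → transform a u0 v0 x x ≡ false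
  transform-irrefl a-irrefl x rewrite a-irrefl x with x == u0 | a v0 x
  ... | true  | true  = refl
  ... | true  | false = refl
  ... | false | _     = refl

transformGraph : ∀ {n} → Graph n → Fin n → Fin n → Graph n
transformGraph G u0 v0 = record
  { adj    = transform (adj G) u0 v0
  ; sym    = transform-sym (adj G) u0 v0 (Graph.sym G)
  ; irrefl = transform-irrefl (adj G) u0 v0 (irrefl G)
  }

cases-on-pair : ∀ {n} {P : Fin n → Set} p q → P p → P q → (∀ y → y ≢ p → y ≢ q → P y) → ∀ y → P y
cases-on-pair {P = P} p q at-p at-q elsewhere y with y ≟ p | y ≟ q
... | yes y≡p | _       = subst P (sym y≡p) at-p
... | no _    | yes y≡q = subst P (sym y≡q) at-q
... | no y≢p  | no y≢q  = elsewhere y y≢p y≢q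

indicator : Bool → ℕ
indicator b = if b then 1 else 0

indicator-∨ : ∀ β γ → ¬ (β ≡ true × γ ≡ true) → indicator (β ∨ γ) ≡ indicator β + indicator γ
indicator-∨ true  true  not-both = ⊥-elim (not-both (refl , refl))
indicator-∨ true  false _        = refl
indicator-∨ false γ     _        = refl

deg≡∑indicator : ∀ {n} (a : Fin n → Fin n → Bool) v → deg a v ≡ ∑[ w < n ] indicator (a v w)
deg≡∑indicator a v = sum-allFin (λ w → indicator (a v w))

sum-of-squares<square : ∀ {p q D} → 2 ≤ p → 2 ≤ q → D + 1 ≡ p + q → p ^ 2 + q ^ 2 < D ^ 2
sum-of-squares<square {suc (suc p)} {suc (suc q)} {D} (s≤s (s≤s z≤n)) (s≤s (s≤s z≤n)) D+1≡p+q
  = subst (λ D → (2 + p) ^ 2 + (2 + q) ^ 2 < D ^ 2)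
      (sym (+-cancelʳ-≡ 1 D (3 + p + q) (trans D+1≡p+q (shift p q))))
      (m+n≤o⇒m≤o _ (≤-reflexive (expand p q)))
  where
  shift : ∀ p q → 2 + p + (2 + q) ≡ 3 + p + q + 1
  shift = solve-∀
  -- x ^ 2 unfolds to x * (x * 1), the form the solver accepts.
  expand : ∀ p q → suc ((2 + p) * ((2 + p) * 1) + (2 + q) * ((2 + q) * 1)) + (2 * p + 2 * q + 2 * p * q)
                   ≡ (3 + p + q) * ((3 + p + q) * 1)
  expand = solve-∀

module Relocation {n} (G : Graph n) (u0 v0 : Fin n) (u0~v0 : adj G u0 v0 ≡ true)
  (disjoint : ∀ w → ¬ (adj G u0 w ≡ true × adj G v0 w ≡ true))
  (2≤deg-u0 : 2 ≤ deg (adj G) u0) (2≤deg-v0 : 2 ≤ deg (adj G) v0) where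

  a b : Fin n → Fin n → Bool
  a = adj G
  b = adj (transformGraph G u0 v0)

  u0≢v0 : u0 ≢ v0
  u0≢v0 refl = case trans (sym u0~v0) (irrefl G u0) of λ ()

  v0~u0 : a v0 u0 ≡ true
  v0~u0 = trans (Graph.sym G v0 u0) u0~v0

  b-away : ∀ {x y} → x ≢ u0 → x ≢ v0 → y ≢ u0 → y ≢ v0 → b x y ≡ a x y
  b-away {x} {y} x≢u0 x≢v0 y≢u0 y≢v0
    rewrite ==-≢ x≢u0 | ==-≢ x≢v0 | ==-≢ y≢u0 | ==-≢ y≢v0 with a x y
  ... | true  = refl
  ... | false = refl

  b-to-v0 : ∀ {x} → x ≢ u0 → x ≢ v0 → b x v0 ≡ false
  b-to-v0 {x} x≢u0 x≢v0
    rewrite ==-≢ x≢u0 | ==-≢ x≢v0 | ==-≢ (u0≢v0 ∘ sym) | ==-refl v0 with a x v0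
  ... | true  = refl
  ... | false = refl

  b-to-u0 : ∀ {x} → x ≢ u0 → x ≢ v0 → b x u0 ≡ a x u0 ∨ a v0 x
  b-to-u0 {x} x≢u0 x≢v0
    rewrite ==-≢ x≢u0 | ==-≢ x≢v0 | ==-≢ u0≢v0 | ==-refl u0 with a x u0 | a v0 x
  ... | true  | true  = refl
  ... | true  | false = refl
  ... | false | true  = refl
  ... | false | false = refl

  b-u0v0 : b u0 v0 ≡ true
  b-u0v0 rewrite ==-≢ u0≢v0 | ==-≢ (u0≢v0 ∘ sym) | ==-refl u0 | ==-refl v0 | u0~v0 = refl

  b-sym : ∀ x y → b x y ≡ b y x
  b-sym = Graph.sym (transformGraph G u0 v0)

  -- The new neighbourhood of u0 is N(u0) ∪ N(v0) without u0, and the union is disjoint.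
  deg-b-u0 : deg b u0 + 1 ≡ deg a u0 + deg a v0
  deg-b-u0 = begin
    deg b u0 + 1                                                    ≡⟨ cong₂ _+_ (deg≡∑indicator b u0) (sym (∑-δ u0 1)) ⟩
    ∑ (indicator ∘ b u0) + ∑ δ                                      ≡⟨ ∑-distrib-+ (indicator ∘ b u0) δ ⟨
    ∑[ y < n ] (indicator (b u0 y) + δ y)                           ≡⟨ sum-cong-≗ {n} merged-row ⟩
    ∑[ y < n ] (indicator (a u0 y) + indicator (a v0 y))            ≡⟨ ∑-distrib-+ (indicator ∘ a u0) (indicator ∘ a v0) ⟩
    ∑ (indicator ∘ a u0) + ∑ (indicator ∘ a v0)                     ≡⟨ cong₂ _+_ (deg≡∑indicator a u0) (deg≡∑indicator a v0) ⟨
    deg a u0 + deg a v0                                             ∎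
    where
    open ≡-Reasoning
    δ : Fin n → ℕ
    δ y = if y == u0 then 1 else 0
    MergedRow : Fin n → Set
    MergedRow y = indicator (b u0 y) + δ y ≡ indicator (a u0 y) + indicator (a v0 y)
    at-u0 : MergedRow u0
    at-u0 = trans (cong₂ _+_ (cong indicator (irrefl (transformGraph G u0 v0) u0)) (cong indicator (==-refl u0)))
                  (sym (cong₂ _+_ (cong indicator (irrefl G u0)) (cong indicator v0~u0)))
    at-v0 : MergedRow v0
    at-v0 = trans (cong₂ _+_ (cong indicator b-u0v0) (cong indicator (==-≢ (u0≢v0 ∘ sym))))
                  (sym (cong₂ _+_ (cong indicator u0~v0) (cong indicator (irrefl G v0))))
    merged-row : ∀ y → MergedRow y
    merged-row = cases-on-pair u0 v0 at-u0 at-v0 elsewhere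
      where
      elsewhere : ∀ y → y ≢ u0 → y ≢ v0 → MergedRow y
      elsewhere y y≢u0 y≢v0 = begin
        indicator (b u0 y) + δ y                ≡⟨ cong (indicator (b u0 y) +_) (cong indicator (==-≢ y≢u0)) ⟩
        indicator (b u0 y) + 0                  ≡⟨ +-identityʳ _ ⟩
        indicator (b u0 y)                      ≡⟨ cong indicator (trans (b-sym u0 y) (b-to-u0 y≢u0 y≢v0)) ⟩
        indicator (a y u0 ∨ a v0 y)             ≡⟨ cong (λ β → indicator (β ∨ a v0 y)) (Graph.sym G y u0) ⟩
        indicator (a u0 y ∨ a v0 y)             ≡⟨ indicator-∨ (a u0 y) (a v0 y) (disjoint y) ⟩
        indicator (a u0 y) + indicator (a v0 y) ∎

  -- w loses the neighbour v0 exactly when it gains the neighbour u0.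
  deg-b-other : ∀ {w} → w ≢ u0 → w ≢ v0 → deg b w ≡ deg a w
  deg-b-other {w} w≢u0 w≢v0 = +-cancelʳ-≡ (indicator (a w v0)) (deg b w) (deg a w) (begin
    deg b w + indicator (a w v0)                       ≡⟨ cong₂ _+_ (deg≡∑indicator b w) (sym (∑-δ v0 _)) ⟩
    ∑ (indicator ∘ b w) + ∑ (δ v0)                     ≡⟨ ∑-distrib-+ (indicator ∘ b w) (δ v0) ⟨
    ∑[ y < n ] (indicator (b w y) + δ v0 y)            ≡⟨ sum-cong-≗ {n} moved-edge ⟩
    ∑[ y < n ] (indicator (a w y) + δ u0 y)            ≡⟨ ∑-distrib-+ (indicator ∘ a w) (δ u0) ⟩
    ∑ (indicator ∘ a w) + ∑ (δ u0)                     ≡⟨ cong₂ _+_ (sym (deg≡∑indicator a w)) (∑-δ u0 _) ⟩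
    deg a w + indicator (a w v0)                       ∎)
    where
    open ≡-Reasoning
    δ : Fin n → Fin n → ℕ
    δ p y = if y == p then indicator (a w v0) else 0
    δ-at : ∀ p → δ p p ≡ indicator (a w v0)
    δ-at p = cong (λ β → if β then indicator (a w v0) else 0) (==-refl p)
    δ-off : ∀ {p y} → y ≢ p → δ p y ≡ 0
    δ-off y≢p = cong (λ β → if β then indicator (a w v0) else 0) (==-≢ y≢p)
    MovedEdge : Fin n → Set
    MovedEdge y = indicator (b w y) + δ v0 y ≡ indicator (a w y) + δ u0 y
    at-u0 : MovedEdge u0
    at-u0 = begin
      indicator (b w u0) + δ v0 u0               ≡⟨ cong₂ _+_ (cong indicator (b-to-u0 w≢u0 w≢v0)) (δ-off u0≢v0) ⟩
      indicator (a w u0 ∨ a v0 w) + 0            ≡⟨ +-identityʳ _ ⟩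
      indicator (a w u0 ∨ a v0 w)                ≡⟨ cong (λ β → indicator (a w u0 ∨ β)) (Graph.sym G v0 w) ⟩
      indicator (a w u0 ∨ a w v0)                ≡⟨ indicator-∨ (a w u0) (a w v0) not-both ⟩
      indicator (a w u0) + indicator (a w v0)    ≡⟨ cong (indicator (a w u0) +_) (δ-at u0) ⟨
      indicator (a w u0) + δ u0 u0               ∎
      where
      not-both : ¬ (a w u0 ≡ true × a w v0 ≡ true)
      not-both (w~u0 , w~v0) = disjoint w (trans (Graph.sym G u0 w) w~u0 , trans (Graph.sym G v0 w) w~v0)
    at-v0 : MovedEdge v0
    at-v0 = begin
      indicator (b w v0) + δ v0 v0               ≡⟨ cong₂ _+_ (cong indicator (b-to-v0 w≢u0 w≢v0)) (δ-at v0) ⟩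
      indicator (a w v0)                         ≡⟨ +-identityʳ _ ⟨
      indicator (a w v0) + 0                     ≡⟨ cong (indicator (a w v0) +_) (δ-off (u0≢v0 ∘ sym)) ⟨
      indicator (a w v0) + δ u0 v0               ∎
    moved-edge : ∀ y → MovedEdge y
    moved-edge = cases-on-pair u0 v0 at-u0 at-v0 λ y y≢u0 y≢v0 →
      cong₂ _+_ (cong indicator (b-away w≢u0 w≢v0 y≢u0 y≢v0)) (trans (δ-off y≢v0) (sym (δ-off y≢u0)))

  deg-a-u0≤deg-b-u0 : deg a u0 ≤ deg b u0
  deg-a-u0≤deg-b-u0 = +-cancelʳ-≤ 1 (deg a u0) (deg b u0)
    (≤-trans (+-monoʳ-≤ (deg a u0) (≤-trans (s≤s z≤n) 2≤deg-v0)) (≤-reflexive (sym deg-b-u0)))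

  deg-a-v0≤deg-b-u0 : deg a v0 ≤ deg b u0
  deg-a-v0≤deg-b-u0 = +-cancelʳ-≤ 1 (deg a v0) (deg b u0)
    (≤-trans (+-monoʳ-≤ (deg a v0) (≤-trans (s≤s z≤n) 2≤deg-u0))
             (≤-reflexive (trans (+-comm (deg a v0) (deg a u0)) (sym deg-b-u0))))

  degSq-u0v0< : degSq a u0 v0 < degSq b u0 v0
  degSq-u0v0< = <-≤-trans (sum-of-squares<square 2≤deg-u0 2≤deg-v0 deg-b-u0) (m≤m+n _ _)

  degSq-mono : ∀ {x y x' y'} → deg a x ≤ deg b x' → deg a y ≤ deg b y' → degSq a x y ≤ degSq b x' y'
  degSq-mono x≤x' y≤y' = +-mono-≤ (^-monoˡ-≤ 2 x≤x') (^-monoˡ-≤ 2 y≤y')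

  deg-a≤deg-b : ∀ {w} → w ≢ u0 → w ≢ v0 → deg a w ≤ deg b w
  deg-a≤deg-b w≢u0 w≢v0 = ≤-reflexive (sym (deg-b-other w≢u0 w≢v0))

  -- the rounding error accumulated by the row-by-row comparison in double-sum<
  slack : ℕ
  slack = n * (n * 1 + 1) + (n * 1 + 2)

  threshold : ℕ
  threshold = 2 * degSq a u0 v0 * suc slack + suc slack * suc slack

  module Scaled (r : ℕ) (r-large : threshold ≤ r) where

    ceilRoot floorRoot : ℕ → ℕ
    ceilRoot  s = csqrt (r * r * s)
    floorRoot s = isqrt (r * r * s)

    A B : Fin n → Fin n → ℕ
    A = weight ceilRoot a
    B = weight floorRoot b

    open WeightComparison ceilRoot floorRoot a b

    sqrt≤ : ∀ {s s'} → s ≤ s' → ceilRoot s ≤ floorRoot s' + 1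
    sqrt≤ = csqrt[N*x]≤isqrt[N*y]+1 (r * r)

    row-away : ∀ {x} → x ≢ u0 → x ≢ v0 → ∑ (A x) ≤ ∑ (B x) + (n * 1 + 1)
    row-away {x} x≢u0 x≢v0 = ≤-trans (≤-reflexive (sym (+-identityʳ _)))
      (∑-≤-pair 1 1 0 u0≢v0 cell merged)
      where
      cell : ∀ y → y ≢ u0 → y ≢ v0 → A x y ≤ B x y + 1
      cell y y≢u0 y≢v0 = weight-≤ 1 (b-away x≢u0 x≢v0 y≢u0 y≢v0)
        (sqrt≤ (degSq-mono (deg-a≤deg-b x≢u0 x≢v0) (deg-a≤deg-b y≢u0 y≢v0)))
      merged : A x u0 + A x v0 + 0 ≤ B x u0 + B x v0 + 1
      merged = begin
        A x u0 + A x v0 + 0   ≡⟨ +-identityʳ _ ⟩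
        A x u0 + A x v0       ≤⟨ weight-merge 1 (trans (b-to-u0 x≢u0 x≢v0) (cong (a x u0 ∨_) (Graph.sym G v0 x))) not-both
                                   (sqrt≤ (degSq-mono (deg-a≤deg-b x≢u0 x≢v0) deg-a-u0≤deg-b-u0))
                                   (sqrt≤ (degSq-mono (deg-a≤deg-b x≢u0 x≢v0) deg-a-v0≤deg-b-u0)) ⟩
        B x u0 + 1            ≡⟨ cong (λ t → t + 1) (+-identityʳ _) ⟨
        B x u0 + 0 + 1        ≡⟨ cong (λ t → B x u0 + t + 1) (weight-absent (b-to-v0 x≢u0 x≢v0)) ⟨
        B x u0 + B x v0 + 1   ∎
        where
        open ≤-Reasoning
        not-both : ¬ (a x u0 ≡ true × a x v0 ≡ true)
        not-both (x~u0 , x~v0) = disjoint x (trans (Graph.sym G u0 x) x~u0 , trans (Graph.sym G v0 x) x~v0)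

    column-away : ∀ y → y ≢ u0 → y ≢ v0 → A u0 y + A v0 y ≤ B u0 y + B v0 y + 1
    column-away y y≢u0 y≢v0 = begin
      A u0 y + A v0 y       ≤⟨ weight-merge 1 u0~y-after (disjoint y)
                                 (sqrt≤ (degSq-mono deg-a-u0≤deg-b-u0 (deg-a≤deg-b y≢u0 y≢v0)))
                                 (sqrt≤ (degSq-mono deg-a-v0≤deg-b-u0 (deg-a≤deg-b y≢u0 y≢v0))) ⟩
      B u0 y + 1            ≡⟨ cong (λ t → t + 1) (+-identityʳ _) ⟨
      B u0 y + 0 + 1        ≡⟨ cong (λ t → B u0 y + t + 1) (weight-absent v0≁y-after) ⟨
      B u0 y + B v0 y + 1   ∎
      where
      open ≤-Reasoning
      u0~y-after : b u0 y ≡ a u0 y ∨ a v0 y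
      u0~y-after = trans (b-sym u0 y) (trans (b-to-u0 y≢u0 y≢v0) (cong (_∨ a v0 y) (Graph.sym G y u0)))
      v0≁y-after : b v0 y ≡ false
      v0≁y-after = trans (b-sym v0 y) (b-to-v0 y≢u0 y≢v0)

    column-u0 : A u0 u0 + A v0 u0 ≤ B u0 u0 + B v0 u0 + 1
    column-u0 = subst₂ (λ s t → s + A v0 u0 ≤ t + B v0 u0 + 1)
      (sym (weight-irrefl G ceilRoot u0)) (sym (weight-irrefl (transformGraph G u0 v0) floorRoot u0))
      (weight-≤ 1 (trans (b-sym v0 u0) (trans b-u0v0 (sym v0~u0))) (sqrt≤ degSq-v0u0≤))
      where
      degSq-v0u0≤ : degSq a v0 u0 ≤ degSq b v0 u0
      degSq-v0u0≤ = subst₂ _≤_ (+-comm (deg a u0 ^ 2) _) (+-comm (deg b u0 ^ 2) _) (<⇒≤ degSq-u0v0<)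

    column-v0 : A u0 v0 + A v0 v0 + suc slack ≤ B u0 v0 + B v0 v0 + 1
    column-v0 = subst₂ (λ s t → A u0 v0 + s + suc slack ≤ B u0 v0 + t + 1)
      (sym (weight-irrefl G ceilRoot v0)) (sym (weight-irrefl (transformGraph G u0 v0) floorRoot v0))
      (subst₂ (λ X Y → X + suc slack ≤ Y + 1)
        (sym (trans (+-identityʳ _) (cong (λ β → if β then ceilRoot (degSq a u0 v0) else 0) u0~v0)))
        (sym (trans (+-identityʳ _) (cong (λ β → if β then floorRoot (degSq b u0 v0) else 0) b-u0v0)))
        (csqrt[r²x]+H≤isqrt[r²y]+1 r (suc slack) (s≤s z≤n) degSq-u0v0< r-large))

    rows-u0v0 : ∑ (A u0) + ∑ (A v0) + suc slack ≤ ∑ (B u0) + ∑ (B v0) + (n * 1 + 2)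
    rows-u0v0 = subst₂ (λ S T → S + suc slack ≤ T + (n * 1 + 2))
      (∑-distrib-+ (A u0) (A v0)) (∑-distrib-+ (B u0) (B v0))
      (∑-≤-pair 1 2 (suc slack) u0≢v0 column-away (add-columns column-u0 column-v0))
      where
      add-columns : ∀ {P Q R S H} → P ≤ Q + 1 → R + H ≤ S + 1 → P + R + H ≤ Q + S + 2
      add-columns {P} {Q} {R} {S} {H} P≤Q+1 R+H≤S+1 = begin
        P + R + H           ≡⟨ +-assoc P R H ⟩
        P + (R + H)         ≤⟨ +-mono-≤ P≤Q+1 R+H≤S+1 ⟩
        Q + 1 + (S + 1)     ≡⟨ regroup Q S ⟩
        Q + S + 2           ∎
        where
        open ≤-Reasoning
        regroup : ∀ Q S → Q + 1 + (S + 1) ≡ Q + S + 2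
        regroup = solve-∀

    double-sum< : ∑[ u < n ] ∑[ v < n ] A u v < ∑[ u < n ] ∑[ v < n ] B u v
    double-sum< = +-cancelʳ-≤ slack _ _ (begin
      suc (∑[ u < n ] ∑[ v < n ] A u v) + slack   ≡⟨ +-suc _ slack ⟨
      ∑[ u < n ] ∑[ v < n ] A u v + suc slack     ≤⟨ ∑-≤-pair (n * 1 + 1) (n * 1 + 2) (suc slack) u0≢v0
                                                        (λ x x≢u0 x≢v0 → row-away x≢u0 x≢v0) rows-u0v0 ⟩
      ∑[ u < n ] ∑[ v < n ] B u v + slack         ∎)
      where open ≤-Reasoning

  ceil-SO<floor-SO : ∀ r → threshold ≤ r →
    sum (map (λ s → csqrt (r * r * s)) (soTerms a)) < sum (map (λ s → isqrt (r * r * s)) (soTerms b))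
  ceil-SO<floor-SO r r-large = *-cancelˡ-< 2 _ _ (subst₂ _<_
    (sym (2*sum-map-soTerms G _)) (sym (2*sum-map-soTerms (transformGraph G u0 v0) _))
    (Scaled.double-sum< r r-large))

4^k≡2^k*2^k : ∀ k → 4 ^ k ≡ 2 ^ k * 2 ^ k
4^k≡2^k*2^k zero    = refl
4^k≡2^k*2^k (suc k) = trans (cong (4 *_) (4^k≡2^k*2^k k)) (regroup (2 ^ k))
  where
  regroup : ∀ t → 4 * (t * t) ≡ 2 * t * (2 * t)
  regroup = solve-∀

k≤2^k : ∀ k → k ≤ 2 ^ k
k≤2^k zero    = z≤n
k≤2^k (suc k) = begin
  suc k           ≤⟨ +-mono-≤ (m^n>0 2 k) (k≤2^k k) ⟩
  2 ^ k + 2 ^ k   ≡⟨ cong (2 ^ k +_) (+-identityʳ (2 ^ k)) ⟨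
  2 ^ suc k       ∎
  where open ≤-Reasoning

lemma2p3 : {n : ℕ} (G : Graph n) (u0 v0 : Fin n) →
    adj G u0 v0 ≡ true →
    (∀ w → ¬ (adj G u0 w ≡ true × adj G v0 w ≡ true)) →
    2 ≤ deg (adj G) u0 →
    2 ≤ deg (adj G) v0 →
    SO< (adj G) (transform (adj G) u0 v0)
lemma2p3 G u0 v0 u0~v0 disjoint 2≤deg-u0 2≤deg-v0 = k ,
  subst (λ N → sum (map (λ s → csqrt (N * s)) (soTerms a)) < sum (map (λ s → isqrt (N * s)) (soTerms b)))
    (sym (4^k≡2^k*2^k k)) (ceil-SO<floor-SO (2 ^ k) (k≤2^k k))
  where
  open Relocation G u0 v0 u0~v0 disjoint 2≤deg-u0 2≤deg-v0
  k = threshold
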